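{- Let $m \geq 3$ be an odd integer. Then the Nest graph $\mathcal{N}(4m;2,m,m+2;2m-1)$ is arc-transitive and its vertex stabilizers (in the full automorphism group) have order $6$.
   Context: For integers $n \geq 4$ and $1 \leq a,b,c,k \leq n-1$ with $k \neq n/2$ and $a,b,c$ pairwise distinct, the Nest graph $\mathcal{N}(n;a,b,c;k)$ is the graph with vertex set $\{u_i : i \in \mathbb{Z}_n\} \cup \{v_i : i \in \mathbb{Z}_n\}$ and edges $u_iu_{i+1}$, $v_iv_{i+k}$, $u_iv_i$, $u_iv_{i+a}$, $u_iv_{i+b}$, $u_iv_{i+c}$ for $i \in \mathbb{Z}_n$ (indices modulo $n$). Arc-transitive means the automorphism group acts transitively on arcs. -}

module Defs where

open import Data.Nat using (ℕ; zero; suc; _+_)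
open import Data.Nat.DivMod using (_mod_)
open import Data.Fin using (Fin; toℕ)
open import Data.Product using (Σ; _×_; ∃)
open import Data.Sum using (_⊎_)
open import Relation.Binary.PropositionalEquality using (_≡_; _≢_)
open import Relation.Nullary using (¬_)

record Graph : Set₁ where
  field
    V   : Set
    Adj : V → V → Set
open Graph public

sucMod : ∀ {n} → Fin n → Fin n
sucMod {suc n} i = suc (toℕ i) mod suc n

_+ₘ_ : ∀ {n} → Fin n → ℕ → Fin n
i +ₘ zero  = i
i +ₘ suc a = sucMod (i +ₘ a)

data NestV (n : ℕ) : Set where
  u : Fin n → NestV n
  v : Fin n → NestV n

data NestEdge (n a b c k : ℕ) : NestV n → NestV n → Set where
  uu  : ∀ i → NestEdge n a b c k (u i) (u (i +ₘ 1))
  vv  : ∀ i → NestEdge n a b c k (v i) (v (i +ₘ k))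
  uv0 : ∀ i → NestEdge n a b c k (u i) (v i)
  uva : ∀ i → NestEdge n a b c k (u i) (v (i +ₘ a))
  uvb : ∀ i → NestEdge n a b c k (u i) (v (i +ₘ b))
  uvc : ∀ i → NestEdge n a b c k (u i) (v (i +ₘ c))

Nest : (n a b c k : ℕ) → Graph
Nest n a b c k = record
  { V   = NestV n
  ; Adj = λ x y → NestEdge n a b c k x y ⊎ NestEdge n a b c k y x }

record Aut (G : Graph) : Set where
  field
    f       : V G → V G
    f⁻¹     : V G → V G
    left    : ∀ x → f⁻¹ (f x) ≡ x
    right   : ∀ x → f (f⁻¹ x) ≡ x
    pres    : ∀ x y → Adj G x y → Adj G (f x) (f y)
    refl'   : ∀ x y → Adj G (f x) (f y) → Adj G x y
open Aut public

_≈ᴬ_ : ∀ {G} → Aut G → Aut G → Set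
σ ≈ᴬ τ = ∀ x → f σ x ≡ f τ x

ArcTransitive : Graph → Set
ArcTransitive G = ∀ x y x' y' → Adj G x y → Adj G x' y' →
  Σ (Aut G) λ σ → f σ x ≡ x' × f σ y ≡ y'

-- the stabilizer of x in Aut(G) has exactly k elements:
-- an enumeration σ₀,…,σ_{k-1} of pairwise distinct automorphisms fixing x,
-- and every automorphism fixing x is one of them
StabilizerOrder : (G : Graph) → V G → ℕ → Set
StabilizerOrder G x k =
  Σ (Fin k → Aut G) λ σ →
    (∀ i → f (σ i) x ≡ x) ×
    (∀ i j → i ≢ j → ¬ (σ i ≈ᴬ σ j)) ×
    (∀ (τ : Aut G) → f τ x ≡ x → ∃ λ i → τ ≈ᴬ σ i)

-- Write m = 2g + 3 and M = 2m = 4g + 6. Sending u_{2y} ↦ O_y, u_{2y+1} ↦ A_{y+1},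
-- v_{2y} ↦ B_y and v_{2y+1} ↦ C_{y+3g+5} (indices in ℤ_M) identifies the Nest graph with
-- the graph in which O_j is adjacent to X_j and X_{j+1} for every layer X ∈ {A, B, C}, and
-- X_j to X⁺_{j+g+1} and X⁺_{j+g+2}, where X⁺ is the cyclic successor of X. Translations,
-- the cyclic relabelling of the layers, a reflection j ↦ β − j (exchanging B and C) and an
-- involution exchanging O with A are automorphisms; they act transitively on vertices, and
-- the stabiliser of O_0 permutes its six neighbours regularly. Conversely an automorphism
-- fixing O_0 and A_1 is trivial: among the neighbours of A_{j+1} other than O_j, only
-- O_{j+1} has three common neighbours with O_j, so fixing O_j and A_{j+1} forces fixing
-- O_{j+1}; conjugating by the automorphism A_l ↦ O_l, O_l ↦ A_{l+1} turns this into the step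
-- from (A_l, O_l) to A_{l+1}. So all of O and A is fixed, and then so are B and C. Hence the
-- automorphism group acts regularly on arcs, with vertex stabilisers of order 6.

module Submission where

open import Defs
open import Data.Empty using (⊥-elim)
open import Data.Fin using (Fin; toℕ; _≟_)
open import Data.Fin.Patterns using (0F; 1F; 2F; 3F; 4F; 5F)
open import Data.Fin.Properties using (toℕ-injective; toℕ<n; toℕ-fromℕ<)
open import Data.List using (_∷_; [])
open import Data.Nat using (ℕ; zero; suc; _+_; _*_; _∸_; _≤_; _<_; z≤n; s≤s; ⌊_/2⌋; parity)
open import Data.Nat.DivMod
  using (_%_; _mod_; m%n<n; m%n%n≡m%n; [m+kn]%n≡m%n; m<n⇒m%n≡m; %-distribˡ-+; %-distribˡ-*;
         m*n%n≡0; m%n*o≡m*o%[n*o]; [m*n+o]%[p*n]≡[m*n]%[p*n]+o)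
open import Data.Nat.Properties
  using (+-identityʳ; +-assoc; +-comm; *-identityˡ; *-comm; *-suc; *-zeroʳ; *-distribˡ-+;
         m+[n∸m]≡n; m≤m+n; m≤n*m; n≤1+n; n<1+n; 0≢1+n; ≤-refl; ≤-reflexive; ≤-trans; <-trans;
         <⇒≤; <⇒≢; <⇒≱; +-mono-≤; +-monoʳ-≤; *-monoˡ-≤)
open import Data.Nat.Tactic.RingSolver using (solve)
open import Data.Parity.Base using (Parity; 0ℙ; 1ℙ)
open import Data.Product using (Σ; _×_; _,_; proj₁; proj₂; ∃; uncurry)
open import Data.Sum using (_⊎_; inj₁; inj₂)
open import Relation.Binary.PropositionalEquality
  using (_≡_; _≢_; refl; sym; trans; cong; cong₂; subst; subst₂; module ≡-Reasoning)
open import Relation.Nullary using (¬_; yes; no)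

module _ {G : Graph} where

  Fixes : Aut G → V G → Set
  Fixes σ x = f σ x ≡ x

  mkAut : (F F⁻¹ : V G → V G) → (∀ x → F⁻¹ (F x) ≡ x) → (∀ x → F (F⁻¹ x) ≡ x) →
          (∀ x y → Adj G x y → Adj G (F x) (F y)) →
          (∀ x y → Adj G x y → Adj G (F⁻¹ x) (F⁻¹ y)) → Aut G
  mkAut F F⁻¹ l r p q = record
    { f = F ; f⁻¹ = F⁻¹ ; left = l ; right = r ; pres = p
    ; refl' = λ x y a → subst₂ (Adj G) (l x) (l y) (q (F x) (F y) a) }

  f⁻¹-pres : (σ : Aut G) → ∀ x y → Adj G x y → Adj G (f⁻¹ σ x) (f⁻¹ σ y)
  f⁻¹-pres σ x y a = refl' σ _ _ (subst₂ (Adj G) (sym (right σ x)) (sym (right σ y)) a)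

  idᴬ : Aut G
  idᴬ = mkAut (λ x → x) (λ x → x) (λ _ → refl) (λ _ → refl) (λ _ _ a → a) (λ _ _ a → a)

  infixr 9 _∘ᴬ_
  _∘ᴬ_ : Aut G → Aut G → Aut G
  σ ∘ᴬ τ = mkAut (λ x → f σ (f τ x)) (λ x → f⁻¹ τ (f⁻¹ σ x))
    (λ x → trans (cong (f⁻¹ τ) (left σ (f τ x))) (left τ x))
    (λ x → trans (cong (f σ) (right τ (f⁻¹ σ x))) (right σ x))
    (λ x y a → pres σ _ _ (pres τ x y a))
    (λ x y a → f⁻¹-pres τ _ _ (f⁻¹-pres σ x y a))

  infix 10 _⁻¹ᴬ
  _⁻¹ᴬ : Aut G → Aut G
  σ ⁻¹ᴬ = mkAut (f⁻¹ σ) (f σ) (right σ) (left σ) (f⁻¹-pres σ) (pres σ)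

  f-injective : (σ : Aut G) → ∀ {x y} → f σ x ≡ f σ y → x ≡ y
  f-injective σ {x} {y} e = trans (sym (left σ x)) (trans (cong (f⁻¹ σ) e) (left σ y))

  f⁻¹-≡ : (σ : Aut G) → ∀ {x y} → f σ x ≡ y → f⁻¹ σ y ≡ x
  f⁻¹-≡ σ {x} e = trans (cong (f⁻¹ σ) (sym e)) (left σ x)

  conj : Aut G → Aut G → Aut G
  conj τ σ = τ ∘ᴬ σ ∘ᴬ τ ⁻¹ᴬ

  Fixes-conj : (τ σ : Aut G) → ∀ {a b} → f τ a ≡ b → Fixes σ a → Fixes (conj τ σ) b
  Fixes-conj τ σ e fa = trans (cong (λ t → f τ (f σ t)) (f⁻¹-≡ τ e)) (trans (cong (f τ) fa) e)

  Fixes-conj⁻ : (τ σ : Aut G) → ∀ {a b} → f τ a ≡ b → Fixes (conj τ σ) b → Fixes σ a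
  Fixes-conj⁻ τ σ e fb =
    f-injective τ (trans (cong (λ t → f τ (f σ t)) (sym (f⁻¹-≡ τ e))) (trans fb (sym e)))

  ThreeCommonNeighbours : V G → V G → Set
  ThreeCommonNeighbours x z = Σ (V G) λ w₁ → Σ (V G) λ w₂ → Σ (V G) λ w₃ →
    (Adj G x w₁ × Adj G w₁ z) × (Adj G x w₂ × Adj G w₂ z) × (Adj G x w₃ × Adj G w₃ z) ×
    w₁ ≢ w₂ × w₁ ≢ w₃ × w₂ ≢ w₃

  ThreeCommonNeighbours-pres : (σ : Aut G) → ∀ {x z} →
    ThreeCommonNeighbours x z → ThreeCommonNeighbours (f σ x) (f σ z)
  ThreeCommonNeighbours-pres σ
    (w₁ , w₂ , w₃ , (a₁ , b₁) , (a₂ , b₂) , (a₃ , b₃) , n₁₂ , n₁₃ , n₂₃) =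
    f σ w₁ , f σ w₂ , f σ w₃ ,
    (pres σ _ _ a₁ , pres σ _ _ b₁) , (pres σ _ _ a₂ , pres σ _ _ b₂) ,
    (pres σ _ _ a₃ , pres σ _ _ b₃) ,
    (λ e → n₁₂ (f-injective σ e)) , (λ e → n₁₃ (f-injective σ e)) ,
    (λ e → n₂₃ (f-injective σ e))

  twoCandidates⇒¬ThreeCommonNeighbours : ∀ {x z} (w w' : V G) →
    (∀ y → Adj G x y → Adj G y z → y ≡ w ⊎ y ≡ w') → ¬ ThreeCommonNeighbours x z
  twoCandidates⇒¬ThreeCommonNeighbours w w' h
    (w₁ , w₂ , w₃ , (a₁ , b₁) , (a₂ , b₂) , (a₃ , b₃) , n₁₂ , n₁₃ , n₂₃)
    with h w₁ a₁ b₁ | h w₂ a₂ b₂ | h w₃ a₃ b₃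
  ... | inj₁ e₁ | inj₁ e₂ | _       = n₁₂ (trans e₁ (sym e₂))
  ... | inj₂ e₁ | inj₂ e₂ | _       = n₁₂ (trans e₁ (sym e₂))
  ... | inj₁ e₁ | inj₂ _  | inj₁ e₃ = n₁₃ (trans e₁ (sym e₃))
  ... | inj₂ e₁ | inj₁ _  | inj₂ e₃ = n₁₃ (trans e₁ (sym e₃))
  ... | inj₁ _  | inj₂ e₂ | inj₂ e₃ = n₂₃ (trans e₂ (sym e₃))
  ... | inj₂ _  | inj₁ e₂ | inj₁ e₃ = n₂₃ (trans e₂ (sym e₃))

module ArcRegular {G : Graph} {k : ℕ} (x₀ y₀ : V G) (x₀~y₀ : Adj G x₀ y₀)
  (nb : Fin k → V G) (nb-injective : ∀ {i j} → nb i ≡ nb j → i ≡ j)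
  (nb-complete : ∀ y → Adj G x₀ y → ∃ λ i → y ≡ nb i)
  (rot : Fin k → Aut G) (rot-x₀ : ∀ i → Fixes (rot i) x₀) (rot-y₀ : ∀ i → f (rot i) y₀ ≡ nb i)
  (move : V G → Aut G) (move-x₀ : ∀ x → f (move x) x₀ ≡ x)
  (rigid : ∀ (σ : Aut G) → Fixes σ x₀ → Fixes σ y₀ → ∀ y → Fixes σ y) where

  agreeOnBaseArc⇒≈ : ∀ σ τ → f σ x₀ ≡ f τ x₀ → f σ y₀ ≡ f τ y₀ → σ ≈ᴬ τ
  agreeOnBaseArc⇒≈ σ τ ex ey y =
    trans (sym (right τ (f σ y)))
      (cong (f τ) (rigid (τ ⁻¹ᴬ ∘ᴬ σ) (f⁻¹-≡ τ (sym ex)) (f⁻¹-≡ τ (sym ey)) y))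

  toArc : ∀ x y → Adj G x y → Σ (Aut G) λ α → f α x₀ ≡ x × f α y₀ ≡ y
  toArc x y x~y = move x ∘ᴬ rot i ,
    trans (cong (f (move x)) (rot-x₀ i)) (move-x₀ x) ,
    trans (cong (f (move x)) (trans (rot-y₀ i) (sym y'≡nb))) (right (move x) y)
    where
      x₀~y' : Adj G x₀ (f⁻¹ (move x) y)
      x₀~y' = subst (λ t → Adj G t _) (f⁻¹-≡ (move x) (move-x₀ x)) (f⁻¹-pres (move x) x y x~y)
      i = proj₁ (nb-complete _ x₀~y')
      y'≡nb = proj₂ (nb-complete _ x₀~y')

  arcTransitive : ArcTransitive G
  arcTransitive x y x' y' x~y x'~y' with toArc x y x~y | toArc x' y' x'~y'
  ... | α , αx₀ , αy₀ | β , βx₀ , βy₀ =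
    β ∘ᴬ α ⁻¹ᴬ ,
    trans (cong (f β) (f⁻¹-≡ α αx₀)) βx₀ ,
    trans (cong (f β) (f⁻¹-≡ α αy₀)) βy₀

  stabilizerOrder : ∀ x → StabilizerOrder G x k
  stabilizerOrder x = σ , σ-fixes , σ-distinct , σ-complete
    where
      γ = move x
      σ : Fin k → Aut G
      σ i = conj γ (rot i)
      σ-fixes : ∀ i → Fixes (σ i) x
      σ-fixes i = Fixes-conj γ (rot i) (move-x₀ x) (rot-x₀ i)
      σ-γy₀ : ∀ i → f (σ i) (f γ y₀) ≡ f γ (nb i)
      σ-γy₀ i = cong (f γ) (trans (cong (f (rot i)) (left γ y₀)) (rot-y₀ i))
      σ-distinct : ∀ i j → i ≢ j → ¬ (σ i ≈ᴬ σ j)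
      σ-distinct i j i≢j σi≈σj =
        i≢j (nb-injective (f-injective γ
          (trans (sym (σ-γy₀ i)) (trans (σi≈σj (f γ y₀)) (σ-γy₀ j)))))
      σ-complete : ∀ τ → Fixes τ x → ∃ λ i → τ ≈ᴬ σ i
      σ-complete τ τx = i , λ y → trans (sym (right γ (f τ y)))
          (cong (f γ) (trans (cong (λ t → f⁻¹ γ (f τ t)) (sym (right γ y))) (τ'≈rot (f⁻¹ γ y))))
        where
          τ' = conj (γ ⁻¹ᴬ) τ
          τ'x₀ : Fixes τ' x₀
          τ'x₀ = Fixes-conj (γ ⁻¹ᴬ) τ (f⁻¹-≡ γ (move-x₀ x)) τx
          x₀~τ'y₀ : Adj G x₀ (f τ' y₀)
          x₀~τ'y₀ = subst (λ t → Adj G t _) τ'x₀ (pres τ' _ _ x₀~y₀)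
          i = proj₁ (nb-complete _ x₀~τ'y₀)
          τ'≈rot : τ' ≈ᴬ rot i
          τ'≈rot = agreeOnBaseArc⇒≈ τ' (rot i) (trans τ'x₀ (sym (rot-x₀ i)))
                     (trans (proj₂ (nb-complete _ x₀~τ'y₀)) (sym (rot-y₀ i)))

record Iso (G K : Graph) : Set where
  field
    to          : V G → V K
    from        : V K → V G
    from∘to     : ∀ x → from (to x) ≡ x
    to∘from     : ∀ y → to (from y) ≡ y
    to-pres     : ∀ x y → Adj G x y → Adj K (to x) (to y)
    from-pres   : ∀ x y → Adj K x y → Adj G (from x) (from y)

Iso-sym : ∀ {G K} → Iso G K → Iso K G
Iso-sym I = record
  { to = from ; from = to ; from∘to = to∘from ; to∘from = from∘to
  ; to-pres = from-pres ; from-pres = to-pres }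
  where open Iso I

pullAut : ∀ {G K} → Iso G K → Aut K → Aut G
pullAut {G} {K} I σ = mkAut (through (f σ)) (through (f⁻¹ σ))
    (cancel (f σ) (f⁻¹ σ) (left σ)) (cancel (f⁻¹ σ) (f σ) (right σ))
    (λ x y a → from-pres _ _ (pres σ _ _ (to-pres x y a)))
    (λ x y a → from-pres _ _ (f⁻¹-pres σ _ _ (to-pres x y a)))
  where
    open Iso I
    through : (V K → V K) → V G → V G
    through h x = from (h (to x))
    cancel : ∀ h h' → (∀ y → h' (h y) ≡ y) → ∀ x → through h' (through h x) ≡ x
    cancel h h' e x =
      trans (cong (λ t → from (h' t)) (to∘from (h (to x)))) (trans (cong from (e (to x))) (from∘to x))

module _ {G K : Graph} (I : Iso G K) where
  open Iso I

  ArcTransitive-transport : ArcTransitive K → ArcTransitive G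
  ArcTransitive-transport arcK x y x' y' x~y x'~y'
    with arcK (to x) (to y) (to x') (to y') (to-pres x y x~y) (to-pres x' y' x'~y')
  ... | σ , σx , σy = pullAut I σ , trans (cong from σx) (from∘to x') , trans (cong from σy) (from∘to y')

  pullAut-cong : ∀ {σ τ} → σ ≈ᴬ τ → pullAut I σ ≈ᴬ pullAut I τ
  pullAut-cong σ≈τ x = cong from (σ≈τ (to x))

  pullAut-injective : ∀ σ τ → pullAut I σ ≈ᴬ pullAut I τ → σ ≈ᴬ τ
  pullAut-injective σ τ eq y = begin
      f σ y                         ≡⟨ cong (f σ) (to∘from y) ⟨
      f σ (to (from y))             ≡⟨ to∘from _ ⟨
      to (from (f σ (to (from y)))) ≡⟨ cong to (eq (from y)) ⟩
      to (from (f τ (to (from y)))) ≡⟨ to∘from _ ⟩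
      f τ (to (from y))             ≡⟨ cong (f τ) (to∘from y) ⟩
      f τ y                         ∎
    where open ≡-Reasoning

  pullAut-pullAut⁻ : ∀ τ → pullAut I (pullAut (Iso-sym I) τ) ≈ᴬ τ
  pullAut-pullAut⁻ τ z = trans (from∘to _) (cong (f τ) (from∘to z))

  StabilizerOrder-transport : ∀ x k → StabilizerOrder K (to x) k → StabilizerOrder G x k
  StabilizerOrder-transport x k (σ , σ-fixes , σ-distinct , σ-complete) =
    (λ i → pullAut I (σ i)) , pulled-fixes , pulled-distinct , pulled-complete
    where
      pulled-fixes : ∀ i → Fixes (pullAut I (σ i)) x
      pulled-fixes i = trans (cong from (σ-fixes i)) (from∘to x)
      pulled-distinct : ∀ i j → i ≢ j → ¬ (pullAut I (σ i) ≈ᴬ pullAut I (σ j))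
      pulled-distinct i j i≢j eq = σ-distinct i j i≢j (pullAut-injective (σ i) (σ j) eq)
      pulled-complete : ∀ τ → Fixes τ x → ∃ λ i → τ ≈ᴬ pullAut I (σ i)
      pulled-complete τ τx
        with σ-complete (pullAut (Iso-sym I) τ) (trans (cong (λ t → to (f τ t)) (from∘to x)) (cong to τx))
      ... | i , τ⁻≈σi = i , λ z →
        trans (sym (pullAut-pullAut⁻ τ z)) (pullAut-cong {pullAut (Iso-sym I) τ} {σ i} τ⁻≈σi z)

module Residues (M' : ℕ) where
  M : ℕ
  M = suc M'

  [_] : ℕ → Fin M
  [ x ] = x mod M

  toℕ-[] : ∀ x → toℕ [ x ] ≡ x % M
  toℕ-[] x = toℕ-fromℕ< (m%n<n x M)

  []-≡% : ∀ x y → x % M ≡ y % M → [ x ] ≡ [ y ]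
  []-≡% x y e = toℕ-injective (trans (toℕ-[] x) (trans e (sym (toℕ-[] y))))

  []-≡%⁻¹ : ∀ x y → [ x ] ≡ [ y ] → x % M ≡ y % M
  []-≡%⁻¹ x y e = trans (sym (toℕ-[] x)) (trans (cong toℕ e) (toℕ-[] y))

  [toℕ] : (j : Fin M) → [ toℕ j ] ≡ j
  [toℕ] j = toℕ-injective (trans (toℕ-[] (toℕ j)) (m<n⇒m%n≡m (toℕ<n j)))

  %-≡ : ∀ A B k → A ≡ B + k * M → A % M ≡ B % M
  %-≡ A B k e = trans (cong (_% M) e) ([m+kn]%n≡m%n B k M)

  []-≡ : ∀ A B k → A ≡ B + k * M → [ A ] ≡ [ B ]
  []-≡ A B k e = []-≡% A B (%-≡ A B k e)

  []-+≡ : ∀ x {a} k → a ≡ k * suc M' → [ x + a ] ≡ [ x ]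
  []-+≡ x {a} k e = []-≡ (x + a) x k (cong (x +_) e)

  [%] : ∀ m → [ m % M ] ≡ [ m ]
  [%] m = []-≡% (m % M) m (m%n%n≡m%n m M)

  [m%M+n]%M≡[m+n]%M : ∀ m n → (m % M + n) % M ≡ (m + n) % M
  [m%M+n]%M≡[m+n]%M m n = begin
      (m % M + n) % M         ≡⟨ %-distribˡ-+ (m % M) n M ⟩
      (m % M % M + n % M) % M ≡⟨ cong (λ t → (t + n % M) % M) (m%n%n≡m%n m M) ⟩
      (m % M + n % M) % M     ≡⟨ %-distribˡ-+ m n M ⟨
      (m + n) % M             ∎
    where open ≡-Reasoning

  [c*[y%M]+e]%M≡[c*y+e]%M : ∀ c y e → (c * (y % M) + e) % M ≡ (c * y + e) % M
  [c*[y%M]+e]%M≡[c*y+e]%M c y e = begin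
      (c * (y % M) + e) % M              ≡⟨ %-distribˡ-+ (c * (y % M)) e M ⟩
      ((c * (y % M)) % M + e % M) % M    ≡⟨ cong (λ t → (t + e % M) % M) c*[y%M]%M ⟩
      ((c * y) % M + e % M) % M          ≡⟨ %-distribˡ-+ (c * y) e M ⟨
      (c * y + e) % M                    ∎
    where
      open ≡-Reasoning
      c*[y%M]%M : (c * (y % M)) % M ≡ (c * y) % M
      c*[y%M]%M = begin
        (c * (y % M)) % M             ≡⟨ %-distribˡ-* c (y % M) M ⟩
        ((c % M) * (y % M % M)) % M   ≡⟨ cong (λ t → ((c % M) * t) % M) (m%n%n≡m%n y M) ⟩
        ((c % M) * (y % M)) % M       ≡⟨ %-distribˡ-* c y M ⟨
        (c * y) % M                   ∎

  [%+] : ∀ m c → [ m % M + c ] ≡ [ m + c ]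
  [%+] m c = []-≡% (m % M + c) (m + c) ([m%M+n]%M≡[m+n]%M m c)

  infixl 6 _⊕_
  _⊕_ : Fin M → ℕ → Fin M
  j ⊕ d = [ toℕ j + d ]

  []⊕ : ∀ x d → [ x ] ⊕ d ≡ [ x + d ]
  []⊕ x d = []-≡% (toℕ [ x ] + d) (x + d)
    (trans (cong (λ t → (t + d) % M) (toℕ-[] x)) ([m%M+n]%M≡[m+n]%M x d))

  ⊕-assoc : ∀ j a b → j ⊕ a ⊕ b ≡ j ⊕ (a + b)
  ⊕-assoc j a b = trans ([]⊕ (toℕ j + a) b) (cong [_] (+-assoc (toℕ j) a b))

  ⊕-⊕-≡ : ∀ j a t s → j ⊕ a ⊕ t ⊕ s ≡ j ⊕ (a + t + s)
  ⊕-⊕-≡ j a t s = trans (cong (_⊕ s) (⊕-assoc j a t)) (⊕-assoc j (a + t) s)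

  ⊕-comm : ∀ j a b → j ⊕ a ⊕ b ≡ j ⊕ b ⊕ a
  ⊕-comm j a b = trans (⊕-assoc j a b) (trans (cong (j ⊕_) (+-comm a b)) (sym (⊕-assoc j b a)))

  ⊕-identityʳ : ∀ j → j ⊕ 0 ≡ j
  ⊕-identityʳ j = trans (cong [_] (+-identityʳ (toℕ j))) ([toℕ] j)

  ⊕-cong : ∀ j a b → a % M ≡ b % M → j ⊕ a ≡ j ⊕ b
  ⊕-cong j a b e = []-≡% (toℕ j + a) (toℕ j + b) (begin
      (toℕ j + a) % M     ≡⟨ cong (_% M) (+-comm (toℕ j) a) ⟩
      (a + toℕ j) % M     ≡⟨ [m%M+n]%M≡[m+n]%M a (toℕ j) ⟨
      (a % M + toℕ j) % M ≡⟨ cong (λ t → (t + toℕ j) % M) e ⟩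
      (b % M + toℕ j) % M ≡⟨ [m%M+n]%M≡[m+n]%M b (toℕ j) ⟩
      (b + toℕ j) % M     ≡⟨ cong (_% M) (+-comm b (toℕ j)) ⟩
      (toℕ j + b) % M     ∎)
    where open ≡-Reasoning

  ⊕-≡ : ∀ j a k → a ≡ k * suc M' → j ⊕ a ≡ j
  ⊕-≡ j a k e = trans (⊕-cong j a 0 (%-≡ a 0 k e)) (⊕-identityʳ j)

  ⊕-cancelˡ : ∀ j a b → j ⊕ a ≡ j ⊕ b → a % M ≡ b % M
  ⊕-cancelˡ j a b e = begin
      a % M                          ≡⟨ %-≡ (x + a + (M ∸ x)) a 1 (shift a) ⟨
      (x + a + (M ∸ x)) % M          ≡⟨ [m%M+n]%M≡[m+n]%M (x + a) (M ∸ x) ⟨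
      ((x + a) % M + (M ∸ x)) % M    ≡⟨ cong (λ t → (t + (M ∸ x)) % M) ([]-≡%⁻¹ (x + a) (x + b) e) ⟩
      ((x + b) % M + (M ∸ x)) % M    ≡⟨ [m%M+n]%M≡[m+n]%M (x + b) (M ∸ x) ⟩
      (x + b + (M ∸ x)) % M          ≡⟨ %-≡ (x + b + (M ∸ x)) b 1 (shift b) ⟩
      b % M                          ∎
    where
      open ≡-Reasoning
      x = toℕ j
      shift : ∀ c → x + c + (M ∸ x) ≡ c + 1 * M
      shift c = begin
        x + c + (M ∸ x)   ≡⟨ cong (_+ (M ∸ x)) (+-comm x c) ⟩
        c + x + (M ∸ x)   ≡⟨ +-assoc c x (M ∸ x) ⟩
        c + (x + (M ∸ x)) ≡⟨ cong (c +_) (m+[n∸m]≡n (<⇒≤ (toℕ<n j))) ⟩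
        c + M             ≡⟨ cong (c +_) (+-identityʳ M) ⟨
        c + 1 * M         ∎

  ⊕-injectiveʳ : ∀ j a b → a < M → b < M → a ≢ b → j ⊕ a ≢ j ⊕ b
  ⊕-injectiveʳ j a b a<M b<M a≢b e =
    a≢b (trans (sym (m<n⇒m%n≡m a<M)) (trans (⊕-cancelˡ j a b e) (m<n⇒m%n≡m b<M)))

  ⊕-≢ : ∀ j {a b} → a < b → b < M → j ⊕ a ≢ j ⊕ b
  ⊕-≢ j a<b b<M = ⊕-injectiveʳ j _ _ (<-trans a<b b<M) b<M (<⇒≢ a<b)

  ⊕-inverseʳ : ∀ j d → j ⊕ d ⊕ M' * d ≡ j
  ⊕-inverseʳ j d = trans (⊕-assoc j d (M' * d))
    (⊕-≡ j (d + M' * d) d (trans (cong (d +_) (*-comm M' d)) (sym (*-suc d M'))))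

  ⊕-inverseˡ : ∀ j d → j ⊕ M' * d ⊕ d ≡ j
  ⊕-inverseˡ j d = trans (⊕-comm j (M' * d) d) (⊕-inverseʳ j d)

  ⊕-pred : ∀ j → j ⊕ M' ⊕ 1 ≡ j
  ⊕-pred j = trans (⊕-assoc j M' 1) (⊕-≡ j (M' + 1) 1 (trans (+-comm M' 1) (sym (*-identityˡ M))))

  ⊕-injectiveˡ : ∀ l j d → l ⊕ d ≡ j ⊕ d → l ≡ j
  ⊕-injectiveˡ l j d e = trans (sym (⊕-inverseʳ l d)) (trans (cong (_⊕ (M' * d)) e) (⊕-inverseʳ j d))

  ⊕1-induction : (P : Fin M → Set) → P [ 0 ] → (∀ j → P j → P (j ⊕ 1)) → ∀ j → P j
  ⊕1-induction P p₀ step j = subst P ([toℕ] j) (P[_] (toℕ j))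
    where
      P[_] : ∀ t → P [ t ]
      P[ zero ]  = p₀
      P[ suc t ] = subst P (trans ([]⊕ t 1) (cong [_] (+-comm t 1))) (step [ t ] P[ t ])

  []-≡′ : ∀ A B k k' → A + k * suc M' ≡ B + k' * suc M' → [ A ] ≡ [ B ]
  []-≡′ A B k k' e = []-≡% A B (begin
      A % M              ≡⟨ [m+kn]%n≡m%n A k M ⟨
      (A + k * M) % M    ≡⟨ cong (_% M) e ⟩
      (B + k' * M) % M   ≡⟨ [m+kn]%n≡m%n B k' M ⟩
      B % M              ∎)
    where open ≡-Reasoning

  -- j ↦ β − j, as M' ≡ −1 (mod M).
  mirror : ℕ → Fin M → Fin M
  mirror β j = [ M' * toℕ j + β ]

  mirror-≡ : ∀ {β β'} k k' → β + k * suc M' ≡ β' + k' * suc M' → ∀ j → mirror β j ≡ mirror β' j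
  mirror-≡ {β} {β'} k k' e j = []-≡′ (M' * toℕ j + β) (M' * toℕ j + β') k k' (begin
      M' * toℕ j + β + k * M     ≡⟨ +-assoc (M' * toℕ j) β (k * M) ⟩
      M' * toℕ j + (β + k * M)   ≡⟨ cong (M' * toℕ j +_) e ⟩
      M' * toℕ j + (β' + k' * M) ≡⟨ +-assoc (M' * toℕ j) β' (k' * M) ⟨
      M' * toℕ j + β' + k' * M   ∎)
    where open ≡-Reasoning

  mirror-≡-via : ∀ {S T : Fin M} {γ γ'} j k k' → S ≡ mirror γ j → T ≡ mirror γ' j →
    γ + k * suc M' ≡ γ' + k' * suc M' → S ≡ T
  mirror-≡-via j k k' S≡ T≡ e = trans S≡ (trans (mirror-≡ k k' e j) (sym T≡))

  mirror-⊕ˡ : ∀ β d j → mirror β j ⊕ d ≡ mirror (β + d) j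
  mirror-⊕ˡ β d j = trans ([]⊕ (M' * toℕ j + β) d) (cong [_] (+-assoc (M' * toℕ j) β d))

  mirror-⊕ʳ : ∀ β e j → mirror β (j ⊕ e) ≡ mirror (M' * e + β) j
  mirror-⊕ʳ β e j = []-≡% (M' * toℕ (j ⊕ e) + β) (M' * toℕ j + (M' * e + β)) (begin
      (M' * toℕ (j ⊕ e) + β) % M       ≡⟨ cong (λ t → (M' * t + β) % M) (toℕ-[] (toℕ j + e)) ⟩
      (M' * ((toℕ j + e) % M) + β) % M ≡⟨ [c*[y%M]+e]%M≡[c*y+e]%M M' (toℕ j + e) β ⟩
      (M' * (toℕ j + e) + β) % M       ≡⟨ cong (λ t → (t + β) % M) (*-distribˡ-+ M' (toℕ j) e) ⟩
      (M' * toℕ j + M' * e + β) % M    ≡⟨ cong (_% M) (+-assoc (M' * toℕ j) (M' * e) β) ⟩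
      (M' * toℕ j + (M' * e + β)) % M  ∎)
    where open ≡-Reasoning

  mirror-mirror : ∀ {β β' d} k k' → M' * β + β' + k * suc M' ≡ d + k' * suc M' →
    ∀ j → mirror β' (mirror β j) ≡ j ⊕ d
  mirror-mirror {β} {β'} {d} k k' e j = begin
      mirror β' (mirror β j)              ≡⟨ []-≡% (M' * toℕ (mirror β j) + β') (M' * ((M' * x + β) % M) + β')
                                                 (cong (λ t → (M' * t + β') % M) (toℕ-[] (M' * x + β))) ⟩
      [ M' * ((M' * x + β) % M) + β' ]     ≡⟨ []-≡% (M' * ((M' * x + β) % M) + β') (M' * (M' * x + β) + β')
                                                 ([c*[y%M]+e]%M≡[c*y+e]%M M' (M' * x + β) β') ⟩
      [ M' * (M' * x + β) + β' ]           ≡⟨ []-≡′ (M' * (M' * x + β) + β') (x + d) (x + k) (M' * x + k') (square x) ⟩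
      j ⊕ d                                ∎
    where
      open ≡-Reasoning
      x = toℕ j
      square : ∀ y → M' * (M' * y + β) + β' + (y + k) * suc M' ≡ y + d + (M' * y + k') * suc M'
      square y = begin
        M' * (M' * y + β) + β' + (y + k) * suc M'        ≡⟨ solve (M' ∷ y ∷ β ∷ β' ∷ k ∷ []) ⟩
        y + M' * y * suc M' + (M' * β + β' + k * suc M') ≡⟨ cong (y + M' * y * suc M' +_) e ⟩
        y + M' * y * suc M' + (d + k' * suc M')          ≡⟨ solve (M' ∷ y ∷ d ∷ k' ∷ []) ⟩
        y + d + (M' * y + k') * suc M'                   ∎

  mirror-involutive : ∀ β j → mirror β (mirror β j) ≡ j
  mirror-involutive β j = trans (mirror-mirror {β} {β} {0} 0 β (solve (M' ∷ β ∷ [])) j) (⊕-identityʳ j)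

  mirror-⊕ʳˡ : ∀ β e d j → mirror β (j ⊕ e) ⊕ d ≡ mirror (M' * e + β + d) j
  mirror-⊕ʳˡ β e d j = trans (cong (_⊕ d) (mirror-⊕ʳ β e j)) (mirror-⊕ˡ (M' * e + β) d j)

  []⊕-≡ : ∀ z d w k k' → z + d + k * suc M' ≡ w + k' * suc M' → [ z ] ⊕ d ≡ [ w ]
  []⊕-≡ z d w k k' e = trans ([]⊕ z d) ([]-≡′ (z + d) w k k' e)

data Layer : Set where
  A B C : Layer

next : Layer → Layer
next A = B
next B = C
next C = A

prev : Layer → Layer
prev A = C
prev B = A
prev C = B

prev-next : ∀ X → prev (next X) ≡ X
prev-next A = refl
prev-next B = refl
prev-next C = refl

next-prev : ∀ X → next (prev X) ≡ X
next-prev A = refl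
next-prev B = refl
next-prev C = refl

swapBC : Layer → Layer
swapBC A = A
swapBC B = C
swapBC C = B

swapBC-involutive : ∀ X → swapBC (swapBC X) ≡ X
swapBC-involutive A = refl
swapBC-involutive B = refl
swapBC-involutive C = refl

module Model (g : ℕ) where
  open Residues (5 + 4 * g) public

  data Vertex : Set where
    O : Fin M → Vertex
    P : Layer → Fin M → Vertex

  data Edge : Vertex → Vertex → Set where
    spoke  : ∀ X j → Edge (O j) (P X j)
    spoke⁺ : ∀ X j → Edge (O j) (P X (j ⊕ 1))
    rung   : ∀ X j → Edge (P X j) (P (next X) (j ⊕ (1 + g)))
    rung⁺  : ∀ X j → Edge (P X j) (P (next X) (j ⊕ (2 + g)))

  ModelGraph : Graph
  ModelGraph = record { V = Vertex ; Adj = λ x y → Edge x y ⊎ Edge y x }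

  infix 4 _~_
  _~_ : Vertex → Vertex → Set
  _~_ = Adj ModelGraph

  ~-sym : ∀ {x y} → x ~ y → y ~ x
  ~-sym (inj₁ e) = inj₂ e
  ~-sym (inj₂ e) = inj₁ e

  Edge⇒~ : (F : Vertex → Vertex) → (∀ {x y} → Edge x y → F x ~ F y) → ∀ x y → x ~ y → F x ~ F y
  Edge⇒~ F h x y (inj₁ e) = h e
  Edge⇒~ F h x y (inj₂ e) = ~-sym (h e)

  retarget : ∀ {x Y l l'} → l ≡ l' → Edge x (P Y l) → Edge x (P Y l')
  retarget refl e = e

  involution : (F : Vertex → Vertex) → (∀ x → F (F x) ≡ x) → (∀ {x y} → Edge x y → F x ~ F y) →
    Aut ModelGraph
  involution F FF h = mkAut F F FF FF (Edge⇒~ F h) (Edge⇒~ F h)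

  translate : ℕ → Aut ModelGraph
  translate d = mkAut (shift d) (shift (M' * d)) inverseʳ inverseˡ
      (Edge⇒~ (shift d) (shift-edge d)) (Edge⇒~ (shift (M' * d)) (shift-edge (M' * d)))
    where
      M' = 5 + 4 * g
      shift : ℕ → Vertex → Vertex
      shift d (O j)   = O (j ⊕ d)
      shift d (P X j) = P X (j ⊕ d)
      inverseʳ : ∀ x → shift (M' * d) (shift d x) ≡ x
      inverseʳ (O j)   = cong O (⊕-inverseʳ j d)
      inverseʳ (P X j) = cong (P X) (⊕-inverseʳ j d)
      inverseˡ : ∀ x → shift d (shift (M' * d) x) ≡ x
      inverseˡ (O j)   = cong O (⊕-inverseˡ j d)
      inverseˡ (P X j) = cong (P X) (⊕-inverseˡ j d)
      shift-edge : ∀ d {x y} → Edge x y → shift d x ~ shift d y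
      shift-edge d (spoke X j)  = inj₁ (spoke X (j ⊕ d))
      shift-edge d (spoke⁺ X j) = inj₁ (retarget (⊕-comm j d 1) (spoke⁺ X (j ⊕ d)))
      shift-edge d (rung X j)   = inj₁ (retarget (⊕-comm j d (1 + g)) (rung X (j ⊕ d)))
      shift-edge d (rung⁺ X j)  = inj₁ (retarget (⊕-comm j d (2 + g)) (rung⁺ X (j ⊕ d)))

  rotate : Aut ModelGraph
  rotate = mkAut (relabel next) (relabel prev) (relabel-inverse prev-next) (relabel-inverse next-prev)
      (Edge⇒~ (relabel next) next-edge) (Edge⇒~ (relabel prev) prev-edge)
    where
      relabel : (Layer → Layer) → Vertex → Vertex
      relabel h (O j)   = O j
      relabel h (P X j) = P (h X) j
      relabel-inverse : ∀ {h h'} → (∀ X → h' (h X) ≡ X) → ∀ x → relabel h' (relabel h x) ≡ x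
      relabel-inverse e (O j)   = refl
      relabel-inverse e (P X j) = cong (λ Y → P Y j) (e X)
      next-edge : ∀ {x y} → Edge x y → relabel next x ~ relabel next y
      next-edge (spoke X j)  = inj₁ (spoke (next X) j)
      next-edge (spoke⁺ X j) = inj₁ (spoke⁺ (next X) j)
      next-edge (rung X j)   = inj₁ (rung (next X) j)
      next-edge (rung⁺ X j)  = inj₁ (rung⁺ (next X) j)
      prev-edge : ∀ {x y} → Edge x y → relabel prev x ~ relabel prev y
      prev-edge (spoke X j)  = inj₁ (spoke (prev X) j)
      prev-edge (spoke⁺ X j) = inj₁ (spoke⁺ (prev X) j)
      prev-edge (rung A j)   = inj₁ (rung C j)
      prev-edge (rung B j)   = inj₁ (rung A j)
      prev-edge (rung C j)   = inj₁ (rung B j)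
      prev-edge (rung⁺ A j)  = inj₁ (rung⁺ C j)
      prev-edge (rung⁺ B j)  = inj₁ (rung⁺ A j)
      prev-edge (rung⁺ C j)  = inj₁ (rung⁺ B j)

  reflectᶠ : Vertex → Vertex
  reflectᶠ (O j)   = O (mirror 0 j)
  reflectᶠ (P X j) = P (swapBC X) (mirror 1 j)

  reflect : Aut ModelGraph
  reflect = involution reflectᶠ reflect-involutive reflect-edge
    where
      reflect-involutive : ∀ x → reflectᶠ (reflectᶠ x) ≡ x
      reflect-involutive (O j)   = cong O (mirror-involutive 0 j)
      reflect-involutive (P X j) = cong₂ P (swapBC-involutive X) (mirror-involutive 1 j)
      rung-back : ∀ d j → mirror 1 (j ⊕ d) ⊕ d ≡ mirror 1 j
      rung-back d j = mirror-≡-via j 0 d (mirror-⊕ʳˡ 1 d d j) refl (solve (d ∷ g ∷ []))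
      reflect-edge : ∀ {x y} → Edge x y → reflectᶠ x ~ reflectᶠ y
      reflect-edge (spoke X j) = inj₁ (retarget (mirror-⊕ˡ 0 1 j) (spoke⁺ (swapBC X) (mirror 0 j)))
      reflect-edge (spoke⁺ X j) = inj₁ (retarget
        (mirror-≡-via j 1 0 refl (mirror-⊕ʳ 1 1 j) (solve (g ∷ []))) (spoke (swapBC X) (mirror 0 j)))
      reflect-edge (rung A j)  = inj₂ (retarget (rung-back (1 + g) j) (rung C _))
      reflect-edge (rung B j)  = inj₂ (retarget (rung-back (1 + g) j) (rung B _))
      reflect-edge (rung C j)  = inj₂ (retarget (rung-back (1 + g) j) (rung A _))
      reflect-edge (rung⁺ A j) = inj₂ (retarget (rung-back (2 + g) j) (rung⁺ C _))
      reflect-edge (rung⁺ B j) = inj₂ (retarget (rung-back (2 + g) j) (rung⁺ B _))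
      reflect-edge (rung⁺ C j) = inj₂ (retarget (rung-back (2 + g) j) (rung⁺ A _))

  swapOAᶠ : Vertex → Vertex
  swapOAᶠ (O j)   = P A (mirror 0 j)
  swapOAᶠ (P A j) = O (mirror 0 j)
  swapOAᶠ (P B j) = P B (mirror (2 + g) j)
  swapOAᶠ (P C j) = P C (mirror (5 + 3 * g) j)

  swapOA : Aut ModelGraph
  swapOA = involution swapOAᶠ swapOA-involutive swapOA-edge
    where
      swapOA-involutive : ∀ x → swapOAᶠ (swapOAᶠ x) ≡ x
      swapOA-involutive (O j)   = cong O (mirror-involutive 0 j)
      swapOA-involutive (P A j) = cong (P A) (mirror-involutive 0 j)
      swapOA-involutive (P B j) = cong (P B) (mirror-involutive (2 + g) j)
      swapOA-involutive (P C j) = cong (P C) (mirror-involutive (5 + 3 * g) j)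
      swapOA-edge : ∀ {x y} → Edge x y → swapOAᶠ x ~ swapOAᶠ y
      swapOA-edge (spoke A j)  = inj₂ (spoke A (mirror 0 j))
      swapOA-edge (spoke⁺ A j) = inj₂ (retarget
        (mirror-≡-via j 0 1 (mirror-⊕ʳˡ 0 1 1 j) refl (solve (g ∷ []))) (spoke⁺ A _))
      swapOA-edge (spoke B j)  = inj₁ (retarget (mirror-⊕ˡ 0 (2 + g) j) (rung⁺ A _))
      swapOA-edge (spoke⁺ B j) = inj₁ (retarget
        (mirror-≡-via j 1 0 (mirror-⊕ˡ 0 (1 + g) j) (mirror-⊕ʳ (2 + g) 1 j) (solve (g ∷ []))) (rung A _))
      swapOA-edge (spoke C j)  = inj₂ (retarget
        (mirror-≡-via j 0 1 (mirror-⊕ˡ (5 + 3 * g) (1 + g) j) refl (solve (g ∷ []))) (rung C _))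
      swapOA-edge (spoke⁺ C j) = inj₂ (retarget
        (mirror-≡-via j 0 2 (mirror-⊕ʳˡ (5 + 3 * g) 1 (2 + g) j) refl (solve (g ∷ []))) (rung⁺ C _))
      swapOA-edge (rung A j)   = inj₁ (retarget
        (mirror-≡-via j (1 + g) 0 (mirror-⊕ˡ 0 1 j) (mirror-⊕ʳ (2 + g) (1 + g) j) (solve (g ∷ [])))
        (spoke⁺ B _))
      swapOA-edge (rung⁺ A j)  = inj₁ (retarget
        (mirror-≡-via j (2 + g) 0 refl (mirror-⊕ʳ (2 + g) (2 + g) j) (solve (g ∷ []))) (spoke B _))
      swapOA-edge (rung B j)   = inj₁ (retarget
        (mirror-≡-via j (1 + g) 0 (mirror-⊕ˡ (2 + g) (2 + g) j) (mirror-⊕ʳ (5 + 3 * g) (1 + g) j)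
          (solve (g ∷ []))) (rung⁺ B _))
      swapOA-edge (rung⁺ B j)  = inj₁ (retarget
        (mirror-≡-via j (2 + g) 0 (mirror-⊕ˡ (2 + g) (1 + g) j) (mirror-⊕ʳ (5 + 3 * g) (2 + g) j)
          (solve (g ∷ []))) (rung B _))
      swapOA-edge (rung C j)   = inj₂ (retarget
        (mirror-≡-via j 0 g (mirror-⊕ʳ 0 (1 + g) j) refl (solve (g ∷ []))) (spoke C _))
      swapOA-edge (rung⁺ C j)  = inj₂ (retarget
        (mirror-≡-via j 0 (1 + g) (mirror-⊕ʳˡ 0 (2 + g) 1 j) refl (solve (g ∷ []))) (spoke⁺ C _))

  halfStep : Aut ModelGraph
  halfStep = reflect ∘ᴬ swapOA

  halfStep-A : ∀ l → f halfStep (P A l) ≡ O l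
  halfStep-A l = cong O (mirror-involutive 0 l)

  halfStep-O : ∀ l → f halfStep (O l) ≡ P A (l ⊕ 1)
  halfStep-O l = cong (P A) (mirror-mirror {0} {1} {1} 0 0 (solve (g ∷ [])) l)

  data RungOffset : ℕ → Set where
    short : RungOffset (1 + g)
    long  : RungOffset (2 + g)

  RungOffset-bounds : ∀ {t} → RungOffset t → 1 ≤ t × t ≤ 2 + g
  RungOffset-bounds short = s≤s z≤n , n≤1+n (1 + g)
  RungOffset-bounds long  = s≤s z≤n , ≤-refl

  O-neighbour : ∀ {j w} → O j ~ w → Σ Layer λ Y → w ≡ P Y j ⊎ w ≡ P Y (j ⊕ 1)
  O-neighbour (inj₁ (spoke X _))  = X , inj₁ refl
  O-neighbour (inj₁ (spoke⁺ X _)) = X , inj₂ refl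
  O-neighbour (inj₂ ())

  P-P-adjacent : ∀ {Y q Z l} → P Y q ~ P Z l → Σ ℕ λ t → RungOffset t ×
    ((Z ≡ next Y × l ≡ q ⊕ t) ⊎ (Y ≡ next Z × q ≡ l ⊕ t))
  P-P-adjacent (inj₁ (rung _ _))  = 1 + g , short , inj₁ (refl , refl)
  P-P-adjacent (inj₁ (rung⁺ _ _)) = 2 + g , long , inj₁ (refl , refl)
  P-P-adjacent (inj₂ (rung _ _))  = 1 + g , short , inj₂ (refl , refl)
  P-P-adjacent (inj₂ (rung⁺ _ _)) = 2 + g , long , inj₂ (refl , refl)

  data P-Neighbour (X : Layer) (l : Fin M) : Vertex → Set where
    below  : P-Neighbour X l (O l)
    below⁻ : ∀ l' → l' ⊕ 1 ≡ l → P-Neighbour X l (O l')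
    above  : ∀ {t} → RungOffset t → P-Neighbour X l (P (next X) (l ⊕ t))
    above⁻ : ∀ {t} l' → RungOffset t → l' ⊕ t ≡ l → P-Neighbour X l (P (prev X) l')

  P-neighbour : ∀ {X l w} → w ~ P X l → P-Neighbour X l w
  P-neighbour (inj₁ (spoke _ _))   = below
  P-neighbour (inj₁ (spoke⁺ _ l')) = below⁻ l' refl
  P-neighbour {l = l} (inj₁ (rung Y l'))  =
    subst (λ Z → P-Neighbour (next Y) l (P Z l')) (prev-next Y) (above⁻ l' short refl)
  P-neighbour {l = l} (inj₁ (rung⁺ Y l')) =
    subst (λ Z → P-Neighbour (next Y) l (P Z l')) (prev-next Y) (above⁻ l' long refl)
  P-neighbour (inj₂ (rung _ _))    = above short
  P-neighbour (inj₂ (rung⁺ _ _))   = above long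

  two-rungs<M : ∀ {t s} → RungOffset t → RungOffset s → 1 + t + s < M
  two-rungs<M ot os =
    s≤s (≤-trans (+-mono-≤ (s≤s (proj₂ (RungOffset-bounds ot))) (proj₂ (RungOffset-bounds os))) bound)
    where
      bound : 1 + (2 + g) + (2 + g) ≤ 5 + 4 * g
      bound = ≤-trans (≤-reflexive {y = 5 + 2 * g} (solve (g ∷ [])))
        (+-monoʳ-≤ 5 (*-monoˡ-≤ g (s≤s (s≤s (z≤n {2})))))

  1<1+t+s : ∀ {t s} → RungOffset t → 1 < 1 + t + s
  1<1+t+s {t} {s} ot = s≤s (≤-trans (proj₁ (RungOffset-bounds ot)) (m≤m+n t s))

  O-O⊕1-common : ∀ j → ThreeCommonNeighbours {ModelGraph} (O j) (O (j ⊕ 1))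
  O-O⊕1-common j = P A (j ⊕ 1) , P B (j ⊕ 1) , P C (j ⊕ 1) ,
    (inj₁ (spoke⁺ A j) , inj₂ (spoke A (j ⊕ 1))) , (inj₁ (spoke⁺ B j) , inj₂ (spoke B (j ⊕ 1))) ,
    (inj₁ (spoke⁺ C j) , inj₂ (spoke C (j ⊕ 1))) , (λ ()) , (λ ()) , (λ ())

  ¬O-B-common : ∀ j {t} → RungOffset t → ¬ ThreeCommonNeighbours {ModelGraph} (O j) (P B (j ⊕ 1 ⊕ t))
  ¬O-B-common j {t} ot =
    twoCandidates⇒¬ThreeCommonNeighbours {ModelGraph} (P A j) (P A (j ⊕ 1)) common
    where
      common : ∀ w → O j ~ w → w ~ P B (j ⊕ 1 ⊕ t) → w ≡ P A j ⊎ w ≡ P A (j ⊕ 1)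
      common w j~w w~z with O-neighbour j~w
      ... | A , inj₁ refl = inj₁ refl
      ... | A , inj₂ refl = inj₂ refl
      common w j~w w~z | B , inj₁ refl with P-P-adjacent w~z
      ... | _ , _ , inj₁ (() , _)
      ... | _ , _ , inj₂ (() , _)
      common w j~w w~z | B , inj₂ refl with P-P-adjacent w~z
      ... | _ , _ , inj₁ (() , _)
      ... | _ , _ , inj₂ (() , _)
      common w j~w w~z | C , inj₁ refl with P-P-adjacent w~z
      ... | _ , _ , inj₁ (() , _)
      ... | s , os , inj₂ (refl , e) = ⊥-elim (⊕-≢ j (s≤s z≤n) (two-rungs<M ot os)
        (trans (⊕-identityʳ j) (trans e (⊕-⊕-≡ j 1 t s))))
      common w j~w w~z | C , inj₂ refl with P-P-adjacent w~z
      ... | _ , _ , inj₁ (() , _)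
      ... | s , os , inj₂ (refl , e) = ⊥-elim (⊕-≢ j (1<1+t+s ot) (two-rungs<M ot os)
        (trans e (⊕-⊕-≡ j 1 t s)))

  ¬O-C-common : ∀ j {t} l → RungOffset t → l ⊕ t ≡ j ⊕ 1 →
    ¬ ThreeCommonNeighbours {ModelGraph} (O j) (P C l)
  ¬O-C-common j {t} l ot l⊕t≡ =
    twoCandidates⇒¬ThreeCommonNeighbours {ModelGraph} (P A j) (P A (j ⊕ 1)) common
    where
      common : ∀ w → O j ~ w → w ~ P C l → w ≡ P A j ⊎ w ≡ P A (j ⊕ 1)
      common w j~w w~l with O-neighbour j~w
      ... | A , inj₁ refl = inj₁ refl
      ... | A , inj₂ refl = inj₂ refl
      common w j~w w~l | C , inj₁ refl with P-P-adjacent w~l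
      ... | _ , _ , inj₁ (() , _)
      ... | _ , _ , inj₂ (() , _)
      common w j~w w~l | C , inj₂ refl with P-P-adjacent w~l
      ... | _ , _ , inj₁ (() , _)
      ... | _ , _ , inj₂ (() , _)
      common w j~w w~l | B , inj₁ refl with P-P-adjacent w~l
      ... | _ , _ , inj₂ (() , _)
      ... | s , os , inj₁ (refl , l≡) = ⊥-elim (⊕-≢ j
        (+-mono-≤ (proj₁ (RungOffset-bounds os)) (proj₁ (RungOffset-bounds ot)))
        (<-trans (n<1+n (s + t)) (two-rungs<M os ot))
        (trans (sym l⊕t≡) (trans (cong (_⊕ t) l≡) (⊕-assoc j s t))))
      common w j~w w~l | B , inj₂ refl with P-P-adjacent w~l
      ... | _ , _ , inj₂ (() , _)
      ... | s , os , inj₁ (refl , l≡) = ⊥-elim (⊕-≢ j (1<1+t+s os) (two-rungs<M os ot)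
        (trans (sym l⊕t≡) (trans (cong (_⊕ t) l≡) (⊕-⊕-≡ j 1 s t))))

  O-injective : ∀ {a b} → O a ≡ O b → a ≡ b
  O-injective refl = refl

  P-index-injective : ∀ {X Y a b} → P X a ≡ P Y b → a ≡ b
  P-index-injective refl = refl

  ⊕1-≢ : ∀ j → j ⊕ 1 ≢ j
  ⊕1-≢ j e = ⊕-≢ j (s≤s (z≤n {0})) (s≤s (s≤s z≤n)) (trans (⊕-identityʳ j) (sym e))

  O⊕1-uniqueCommonPartner : ∀ j w → w ~ P A (j ⊕ 1) → ThreeCommonNeighbours {ModelGraph} (O j) w →
    w ≢ O j → w ≡ O (j ⊕ 1)
  O⊕1-uniqueCommonPartner j w w~a common w≢ with P-neighbour w~a
  ... | below           = refl
  ... | below⁻ l' e     = ⊥-elim (w≢ (cong O (⊕-injectiveˡ l' j 1 e)))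
  ... | above ot        = ⊥-elim (¬O-B-common j ot common)
  ... | above⁻ l' ot e  = ⊥-elim (¬O-C-common j l' ot e common)

  fixes-O⊕1 : (σ : Aut ModelGraph) → ∀ j →
    Fixes σ (O j) → Fixes σ (P A (j ⊕ 1)) → Fixes σ (O (j ⊕ 1))
  fixes-O⊕1 σ j fo fa = O⊕1-uniqueCommonPartner j (f σ (O (j ⊕ 1)))
    (subst (f σ (O (j ⊕ 1)) ~_) fa (pres σ _ _ (inj₁ (spoke A (j ⊕ 1)))))
    (subst (λ y → ThreeCommonNeighbours {ModelGraph} y (f σ (O (j ⊕ 1)))) fo
      (ThreeCommonNeighbours-pres σ (O-O⊕1-common j)))
    (λ e → ⊕1-≢ j (O-injective (f-injective σ (trans e (sym fo)))))

  fixes-A⊕1 : (σ : Aut ModelGraph) → ∀ l → Fixes σ (P A l) → Fixes σ (O l) → Fixes σ (P A (l ⊕ 1))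
  fixes-A⊕1 σ l fa fo = Fixes-conj⁻ halfStep σ (halfStep-A (l ⊕ 1))
    (fixes-O⊕1 (conj halfStep σ) l (Fixes-conj halfStep σ (halfStep-A l) fa)
      (Fixes-conj halfStep σ (halfStep-O l) fo))

  z₀ z₁ : Fin M
  z₀ = [ 0 ]
  z₁ = z₀ ⊕ 1

  fixes-O-and-A : (σ : Aut ModelGraph) → Fixes σ (O z₀) → Fixes σ (P A z₁) →
    ∀ j → Fixes σ (O j) × Fixes σ (P A (j ⊕ 1))
  fixes-O-and-A σ f₀ f₁ = ⊕1-induction (λ j → Fixes σ (O j) × Fixes σ (P A (j ⊕ 1))) (f₀ , f₁) step
    where
      step : ∀ j → Fixes σ (O j) × Fixes σ (P A (j ⊕ 1)) →
        Fixes σ (O (j ⊕ 1)) × Fixes σ (P A (j ⊕ 1 ⊕ 1))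
      step j (fo , fa) = fo' , fixes-A⊕1 σ (j ⊕ 1) fa fo'
        where fo' = fixes-O⊕1 σ j fo fa

  fixes-O : (σ : Aut ModelGraph) → Fixes σ (O z₀) → Fixes σ (P A z₁) → ∀ j → Fixes σ (O j)
  fixes-O σ f₀ f₁ j = proj₁ (fixes-O-and-A σ f₀ f₁ j)

  fixes-A : (σ : Aut ModelGraph) → Fixes σ (O z₀) → Fixes σ (P A z₁) → ∀ j → Fixes σ (P A j)
  fixes-A σ f₀ f₁ j =
    subst (λ t → Fixes σ (P A t)) (⊕-pred j) (proj₂ (fixes-O-and-A σ f₀ f₁ (j ⊕ (5 + 4 * g))))

  fixes-O⇒~ : (σ : Aut ModelGraph) → (∀ j → Fixes σ (O j)) → ∀ {i y} → O i ~ y → O i ~ f σ y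
  fixes-O⇒~ σ fo {i} {y} a = subst (_~ f σ y) (fo i) (pres σ _ _ a)

  fixes-O⇒same-index : (σ : Aut ModelGraph) → (∀ j → Fixes σ (O j)) →
    ∀ X j → Σ Layer λ Y → f σ (P X j) ≡ P Y j
  fixes-O⇒same-index σ fo X j with O-neighbour (fixes-O⇒~ σ fo (inj₁ (spoke X j)))
  ... | Y , inj₁ e = Y , e
  ... | Y , inj₂ e
    with O-neighbour (fixes-O⇒~ σ fo (inj₁ (retarget (⊕-pred j) (spoke⁺ X (j ⊕ (5 + 4 * g))))))
  ... | _ , inj₁ e' = ⊥-elim (⊕-≢ j (s≤s (s≤s z≤n)) ≤-refl (P-index-injective (trans (sym e) e')))
  ... | _ , inj₂ e' = ⊥-elim (⊕1-≢ j (trans (P-index-injective (trans (sym e) e')) (⊕-pred j)))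

  ⊕[5+3g]⊕[1+g] : ∀ j → j ⊕ (5 + 3 * g) ⊕ (1 + g) ≡ j
  ⊕[5+3g]⊕[1+g] j = trans (⊕-assoc j (5 + 3 * g) (1 + g)) (⊕-≡ j _ 1 (solve (g ∷ [])))

  fixes-B : (σ : Aut ModelGraph) → (∀ j → Fixes σ (O j)) → (∀ j → Fixes σ (P A j)) →
    ∀ j → Fixes σ (P B j)
  fixes-B σ fo fa j with fixes-O⇒same-index σ fo B j
  ... | A , e = ⊥-elim (B≢A (f-injective σ (trans e (sym (fa j)))))
    where
      B≢A : P B j ≢ P A j
      B≢A ()
  ... | B , e = e
  ... | C , e with P-P-adjacent (subst₂ _~_ (fa (j ⊕ (5 + 3 * g))) e
                   (pres σ _ _ (inj₁ (retarget (⊕[5+3g]⊕[1+g] j) (rung A (j ⊕ (5 + 3 * g)))))))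
  ... | _ , _ , inj₁ (() , _)
  ... | t , ot , inj₂ (refl , e') = ⊥-elim (⊕-≢ j t<5+3g 5+3g<M (sym e'))
    where
      5+3g<M : 5 + 3 * g < M
      5+3g<M = s≤s (+-monoʳ-≤ 5 (*-monoˡ-≤ g (s≤s (s≤s (s≤s (z≤n {1}))))))
      t<5+3g : t < 5 + 3 * g
      t<5+3g = s≤s (≤-trans (proj₂ (RungOffset-bounds ot)) (+-mono-≤ (s≤s (s≤s (z≤n {2}))) (m≤n*m g 3)))

  fixes-C : (σ : Aut ModelGraph) →
    (∀ j → Fixes σ (O j)) → (∀ j → Fixes σ (P A j)) → (∀ j → Fixes σ (P B j)) →
    ∀ j → Fixes σ (P C j)
  fixes-C σ fo fa fb j with fixes-O⇒same-index σ fo C j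
  ... | A , e = ⊥-elim (C≢A (f-injective σ (trans e (sym (fa j)))))
    where
      C≢A : P C j ≢ P A j
      C≢A ()
  ... | B , e = ⊥-elim (C≢B (f-injective σ (trans e (sym (fb j)))))
    where
      C≢B : P C j ≢ P B j
      C≢B ()
  ... | C , e = e

  rigid : ∀ σ → Fixes σ (O z₀) → Fixes σ (P A z₁) → ∀ y → Fixes σ y
  rigid σ f₀ f₁ (O j)   = fixes-O σ f₀ f₁ j
  rigid σ f₀ f₁ (P A j) = fixes-A σ f₀ f₁ j
  rigid σ f₀ f₁ (P B j) = fixes-B σ (fixes-O σ f₀ f₁) (fixes-A σ f₀ f₁) j
  rigid σ f₀ f₁ (P C j) = fixes-C σ fo fa (fixes-B σ fo fa) j
    where
      fo = fixes-O σ f₀ f₁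
      fa = fixes-A σ f₀ f₁

  mirror0-z₀ : mirror 0 z₀ ≡ z₀
  mirror0-z₀ = cong [_] (trans (+-identityʳ ((5 + 4 * g) * 0)) (*-zeroʳ (5 + 4 * g)))

  mirror1-z₁ : mirror 1 z₁ ≡ z₀
  mirror1-z₁ = trans (mirror-≡-via z₀ 0 1 (mirror-⊕ʳ 1 1 z₀) refl (solve (g ∷ []))) mirror0-z₀

  z₀≢z₁ : z₀ ≢ z₁
  z₀≢z₁ e = ⊕1-≢ z₀ (sym e)

  nb : Fin 6 → Vertex
  nb 0F = P A z₁
  nb 1F = P B z₁
  nb 2F = P C z₁
  nb 3F = P A z₀
  nb 4F = P C z₀
  nb 5F = P B z₀

  nbIndex : Vertex → Fin 6
  nbIndex (O _) = 0F  -- arbitrary: only the values on the neighbours of O z₀ matter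
  nbIndex (P X l) with l ≟ z₁
  nbIndex (P A l) | yes _ = 0F
  nbIndex (P B l) | yes _ = 1F
  nbIndex (P C l) | yes _ = 2F
  nbIndex (P A l) | no _  = 3F
  nbIndex (P C l) | no _  = 4F
  nbIndex (P B l) | no _  = 5F

  nbIndex-nb : ∀ i → nbIndex (nb i) ≡ i
  nbIndex-nb 0F with z₁ ≟ z₁
  ... | yes _ = refl
  ... | no ¬e = ⊥-elim (¬e refl)
  nbIndex-nb 1F with z₁ ≟ z₁
  ... | yes _ = refl
  ... | no ¬e = ⊥-elim (¬e refl)
  nbIndex-nb 2F with z₁ ≟ z₁
  ... | yes _ = refl
  ... | no ¬e = ⊥-elim (¬e refl)
  nbIndex-nb 3F with z₀ ≟ z₁
  ... | yes e = ⊥-elim (z₀≢z₁ e)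
  ... | no _  = refl
  nbIndex-nb 4F with z₀ ≟ z₁
  ... | yes e = ⊥-elim (z₀≢z₁ e)
  ... | no _  = refl
  nbIndex-nb 5F with z₀ ≟ z₁
  ... | yes e = ⊥-elim (z₀≢z₁ e)
  ... | no _  = refl

  nb-injective : ∀ {i j} → nb i ≡ nb j → i ≡ j
  nb-injective {i} {j} e = trans (sym (nbIndex-nb i)) (trans (cong nbIndex e) (nbIndex-nb j))

  nb-complete : ∀ y → O z₀ ~ y → ∃ λ i → y ≡ nb i
  nb-complete y z₀~y with O-neighbour z₀~y
  ... | A , inj₁ e = 3F , e
  ... | B , inj₁ e = 5F , e
  ... | C , inj₁ e = 4F , e
  ... | A , inj₂ e = 0F , e
  ... | B , inj₂ e = 1F , e
  ... | C , inj₂ e = 2F , e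

  rot : Fin 6 → Aut ModelGraph
  rot 0F = idᴬ
  rot 1F = rotate
  rot 2F = rotate ∘ᴬ rotate
  rot 3F = reflect
  rot 4F = reflect ∘ᴬ rotate
  rot 5F = reflect ∘ᴬ rotate ∘ᴬ rotate

  rot-z₀ : ∀ i → Fixes (rot i) (O z₀)
  rot-z₀ 0F = refl
  rot-z₀ 1F = refl
  rot-z₀ 2F = refl
  rot-z₀ 3F = cong O mirror0-z₀
  rot-z₀ 4F = cong O mirror0-z₀
  rot-z₀ 5F = cong O mirror0-z₀

  rot-z₁ : ∀ i → f (rot i) (P A z₁) ≡ nb i
  rot-z₁ 0F = refl
  rot-z₁ 1F = refl
  rot-z₁ 2F = refl
  rot-z₁ 3F = cong (P A) mirror1-z₁
  rot-z₁ 4F = cong (P C) mirror1-z₁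
  rot-z₁ 5F = cong (P B) mirror1-z₁

  move : Vertex → Aut ModelGraph
  move (O j)   = translate (toℕ j)
  move (P A j) = translate (toℕ j) ∘ᴬ swapOA
  move (P B j) = translate (toℕ j) ∘ᴬ rotate ∘ᴬ swapOA
  move (P C j) = translate (toℕ j) ∘ᴬ rotate ∘ᴬ rotate ∘ᴬ swapOA

  move-z₀ : ∀ x → f (move x) (O z₀) ≡ x
  move-z₀ (O j)   = cong O ([toℕ] j)
  move-z₀ (P A j) = cong (P A) (trans (cong (_⊕ toℕ j) mirror0-z₀) ([toℕ] j))
  move-z₀ (P B j) = cong (P B) (trans (cong (_⊕ toℕ j) mirror0-z₀) ([toℕ] j))
  move-z₀ (P C j) = cong (P C) (trans (cong (_⊕ toℕ j) mirror0-z₀) ([toℕ] j))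

  open ArcRegular (O z₀) (P A z₁) (inj₁ (spoke⁺ A z₀)) nb nb-injective nb-complete
    rot rot-z₀ rot-z₁ move move-z₀ rigid public

parity-even : ∀ y → parity (y * 2) ≡ 0ℙ
parity-even zero    = refl
parity-even (suc y) = parity-even y

parity-odd : ∀ y → parity (y * 2 + 1) ≡ 1ℙ
parity-odd zero    = refl
parity-odd (suc y) = parity-odd y

⌊y*2/2⌋≡y : ∀ y → ⌊ y * 2 /2⌋ ≡ y
⌊y*2/2⌋≡y zero    = refl
⌊y*2/2⌋≡y (suc y) = cong suc (⌊y*2/2⌋≡y y)

⌊y*2+1/2⌋≡y : ∀ y → ⌊ y * 2 + 1 /2⌋ ≡ y
⌊y*2+1/2⌋≡y zero    = refl
⌊y*2+1/2⌋≡y (suc y) = cong suc (⌊y*2+1/2⌋≡y y)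

even-or-odd : ∀ x → ∃ λ y → x ≡ y * 2 ⊎ x ≡ y * 2 + 1
even-or-odd zero = 0 , inj₁ refl
even-or-odd (suc x) with even-or-odd x
... | y , inj₁ e = y , inj₂ (trans (cong suc e) (+-comm 1 (y * 2)))
... | y , inj₂ e = suc y , inj₁ (trans (cong suc e) (cong suc (+-comm (y * 2) 1)))

module Doubling (M' : ℕ) where
  module ℤₘ = Residues M'
  module ℤₙ = Residues (suc (M' * 2))
  open ℤₘ using (M)
  open ℤₙ using () renaming (M to n; [_] to [_]ₙ)

  +ₘ-toℕ : ∀ (i : Fin n) a → toℕ (i +ₘ a) ≡ (toℕ i + a) % n
  +ₘ-toℕ i zero    = sym (trans (cong (_% n) (+-identityʳ (toℕ i))) (m<n⇒m%n≡m (toℕ<n i)))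
  +ₘ-toℕ i (suc a) = begin
      toℕ (suc (toℕ (i +ₘ a)) mod n) ≡⟨ ℤₙ.toℕ-[] (suc (toℕ (i +ₘ a))) ⟩
      suc (toℕ (i +ₘ a)) % n         ≡⟨ cong (λ t → suc t % n) (+ₘ-toℕ i a) ⟩
      (1 + (toℕ i + a) % n) % n      ≡⟨ cong (_% n) (+-comm 1 ((toℕ i + a) % n)) ⟩
      ((toℕ i + a) % n + 1) % n      ≡⟨ ℤₙ.[m%M+n]%M≡[m+n]%M (toℕ i + a) 1 ⟩
      (toℕ i + a + 1) % n            ≡⟨ cong (_% n) (trans (+-assoc (toℕ i) a 1) (cong (toℕ i +_) (+-comm a 1))) ⟩
      (toℕ i + suc a) % n            ∎
    where open ≡-Reasoning

  []ₙ-+ₘ : ∀ z a → [ z ]ₙ +ₘ a ≡ [ z + a ]ₙ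
  []ₙ-+ₘ z a = trans (sym (ℤₙ.[toℕ] ([ z ]ₙ +ₘ a))) (ℤₙ.[]-≡% (toℕ ([ z ]ₙ +ₘ a)) (z + a) (begin
      toℕ ([ z ]ₙ +ₘ a) % n          ≡⟨ cong (_% n) (+ₘ-toℕ [ z ]ₙ a) ⟩
      (toℕ [ z ]ₙ + a) % n % n       ≡⟨ m%n%n≡m%n (toℕ [ z ]ₙ + a) n ⟩
      (toℕ [ z ]ₙ + a) % n           ≡⟨ cong (λ t → (t + a) % n) (ℤₙ.toℕ-[] z) ⟩
      (z % n + a) % n                ≡⟨ ℤₙ.[m%M+n]%M≡[m+n]%M z a ⟩
      (z + a) % n                    ∎))
    where open ≡-Reasoning

  toℕ-[y*2]ₙ : ∀ y → toℕ [ y * 2 ]ₙ ≡ (y % M) * 2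
  toℕ-[y*2]ₙ y = trans (ℤₙ.toℕ-[] (y * 2)) (sym (m%n*o≡m*o%[n*o] y M 2))

  toℕ-[y*2+1]ₙ : ∀ y → toℕ [ y * 2 + 1 ]ₙ ≡ (y % M) * 2 + 1
  toℕ-[y*2+1]ₙ y = trans (ℤₙ.toℕ-[] (y * 2 + 1))
    (trans ([m*n+o]%[p*n]≡[m*n]%[p*n]+o y {2} {1} M (s≤s (s≤s z≤n)))
      (cong (_+ 1) (sym (m%n*o≡m*o%[n*o] y M 2))))

  halve : Fin n → Parity × ℕ
  halve i = parity (toℕ i) , ⌊ toℕ i /2⌋

  halve-even : ∀ y → halve [ y * 2 ]ₙ ≡ (0ℙ , y % M)
  halve-even y = trans (cong (λ t → parity t , ⌊ t /2⌋) (toℕ-[y*2]ₙ y))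
    (cong₂ _,_ (parity-even (y % M)) (⌊y*2/2⌋≡y (y % M)))

  halve-odd : ∀ y → halve [ y * 2 + 1 ]ₙ ≡ (1ℙ , y % M)
  halve-odd y = trans (cong (λ t → parity t , ⌊ t /2⌋) (toℕ-[y*2+1]ₙ y))
    (cong₂ _,_ (parity-odd (y % M)) (⌊y*2+1/2⌋≡y (y % M)))

  double : ℕ → ℕ → Fin M → Fin n
  double c e j = [ (toℕ j + c) * 2 + e ]ₙ

  double-[] : ∀ c e z → double c e ℤₘ.[ z ] ≡ [ (z + c) * 2 + e ]ₙ
  double-[] c e z = ℤₙ.[]-≡% ((toℕ ℤₘ.[ z ] + c) * 2 + e) ((z + c) * 2 + e) (begin
      ((toℕ ℤₘ.[ z ] + c) * 2 + e) % n     ≡⟨ cong (λ t → ((t + c) * 2 + e) % n) (ℤₘ.toℕ-[] z) ⟩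
      ((z % M + c) * 2 + e) % n            ≡⟨ cong (_% n) (expand (z % M)) ⟩
      ((z % M) * 2 + (c * 2 + e)) % n      ≡⟨ cong (λ t → (t + (c * 2 + e)) % n) (m%n*o≡m*o%[n*o] z M 2) ⟩
      ((z * 2) % n + (c * 2 + e)) % n      ≡⟨ ℤₙ.[m%M+n]%M≡[m+n]%M (z * 2) (c * 2 + e) ⟩
      (z * 2 + (c * 2 + e)) % n            ≡⟨ cong (_% n) (expand z) ⟨
      ((z + c) * 2 + e) % n                ∎)
    where
      open ≡-Reasoning
      expand : ∀ w → (w + c) * 2 + e ≡ w * 2 + (c * 2 + e)
      expand w = solve (w ∷ c ∷ e ∷ [])

  double-⊕-+ₘ-⊕ : ∀ c e d a c' e' d' k k' →
    (d + c) * 2 + e + a + k * (suc M' * 2) ≡ (d' + c') * 2 + e' + k' * (suc M' * 2) →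
    ∀ j → double c e (j ℤₘ.⊕ d) +ₘ a ≡ double c' e' (j ℤₘ.⊕ d')
  double-⊕-+ₘ-⊕ c e d a c' e' d' k k' eq j = begin
      double c e (j ℤₘ.⊕ d) +ₘ a          ≡⟨ cong (_+ₘ a) (double-[] c e (toℕ j + d)) ⟩
      [ (toℕ j + d + c) * 2 + e ]ₙ +ₘ a   ≡⟨ []ₙ-+ₘ ((toℕ j + d + c) * 2 + e) a ⟩
      [ (toℕ j + d + c) * 2 + e + a ]ₙ    ≡⟨ ℤₙ.[]-≡′ _ _ k k' (shifted (toℕ j)) ⟩
      [ (toℕ j + d' + c') * 2 + e' ]ₙ     ≡⟨ double-[] c' e' (toℕ j + d') ⟨
      double c' e' (j ℤₘ.⊕ d')            ∎
    where
      open ≡-Reasoning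
      shifted : ∀ x → (x + d + c) * 2 + e + a + k * (suc M' * 2) ≡ (x + d' + c') * 2 + e' + k' * (suc M' * 2)
      shifted x = begin
        (x + d + c) * 2 + e + a + k * (suc M' * 2)         ≡⟨ solve (x ∷ d ∷ c ∷ e ∷ a ∷ k ∷ M' ∷ []) ⟩
        x * 2 + ((d + c) * 2 + e + a + k * (suc M' * 2))    ≡⟨ cong (x * 2 +_) eq ⟩
        x * 2 + ((d' + c') * 2 + e' + k' * (suc M' * 2))    ≡⟨ solve (x ∷ d' ∷ c' ∷ e' ∷ k' ∷ M' ∷ []) ⟩
        (x + d' + c') * 2 + e' + k' * (suc M' * 2)          ∎

  double-⊕0 : ∀ c e j → double c e (j ℤₘ.⊕ 0) ≡ double c e j
  double-⊕0 c e j = cong (double c e) (ℤₘ.⊕-identityʳ j)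

  double-+ₘ-⊕ : ∀ c e a c' e' d' k k' →
    c * 2 + e + a + k * (suc M' * 2) ≡ (d' + c') * 2 + e' + k' * (suc M' * 2) →
    ∀ j → double c e j +ₘ a ≡ double c' e' (j ℤₘ.⊕ d')
  double-+ₘ-⊕ c e a c' e' d' k k' eq j =
    trans (cong (_+ₘ a) (sym (double-⊕0 c e j))) (double-⊕-+ₘ-⊕ c e 0 a c' e' d' k k' eq j)

  double-⊕-+ₘ : ∀ c e d a c' e' k k' →
    (d + c) * 2 + e + a + k * (suc M' * 2) ≡ c' * 2 + e' + k' * (suc M' * 2) →
    ∀ j → double c e (j ℤₘ.⊕ d) +ₘ a ≡ double c' e' j
  double-⊕-+ₘ c e d a c' e' k k' eq j =
    trans (double-⊕-+ₘ-⊕ c e d a c' e' 0 k k' eq j) (double-⊕0 c' e' j)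

  double-+ₘ : ∀ c e a c' e' k k' →
    c * 2 + e + a + k * (suc M' * 2) ≡ c' * 2 + e' + k' * (suc M' * 2) →
    ∀ j → double c e j +ₘ a ≡ double c' e' j
  double-+ₘ c e a c' e' k k' eq j =
    trans (cong (_+ₘ a) (sym (double-⊕0 c e j))) (double-⊕-+ₘ c e 0 a c' e' k k' eq j)

module NestModel (g : ℕ) where
  open Model g
  open Doubling (5 + 4 * g)
  open ℤₙ using () renaming (M to n; [_] to [_]ₙ)

  NestG : Graph
  NestG = Nest n 2 (3 + 2 * g) (5 + 2 * g) (5 + 4 * g)

  φᵘ : Parity → ℕ → Vertex
  φᵘ 0ℙ y = O [ y ]
  φᵘ 1ℙ y = P A [ y + 1 ]

  φᵛ : Parity → ℕ → Vertex
  φᵛ 0ℙ y = P B [ y ]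
  φᵛ 1ℙ y = P C [ y + (5 + 3 * g) ]

  φ : NestV n → Vertex
  φ (u i) = uncurry φᵘ (halve i)
  φ (v i) = uncurry φᵛ (halve i)

  ψ : Vertex → NestV n
  ψ (O j)   = u (double 0 0 j)
  ψ (P A j) = u (double (5 + 4 * g) 1 j)
  ψ (P B j) = v (double 0 0 j)
  ψ (P C j) = v (double (1 + g) 1 j)

  φᵘ-even : ∀ y → φ (u [ y * 2 ]ₙ) ≡ O [ y ]
  φᵘ-even y = trans (cong (uncurry φᵘ) (halve-even y)) (cong O ([%] y))

  φᵘ-odd : ∀ y → φ (u [ y * 2 + 1 ]ₙ) ≡ P A [ y + 1 ]
  φᵘ-odd y = trans (cong (uncurry φᵘ) (halve-odd y)) (cong (P A) ([%+] y 1))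

  φᵛ-even : ∀ y → φ (v [ y * 2 ]ₙ) ≡ P B [ y ]
  φᵛ-even y = trans (cong (uncurry φᵛ) (halve-even y)) (cong (P B) ([%] y))

  φᵛ-odd : ∀ y → φ (v [ y * 2 + 1 ]ₙ) ≡ P C [ y + (5 + 3 * g) ]
  φᵛ-odd y = trans (cong (uncurry φᵛ) (halve-odd y)) (cong (P C) ([%+] y (5 + 3 * g)))

  [x+0]*2+0≡x*2 : ∀ x → (x + 0) * 2 + 0 ≡ x * 2
  [x+0]*2+0≡x*2 x = trans (+-identityʳ _) (cong (_* 2) (+-identityʳ x))

  φ∘ψ : ∀ w → φ (ψ w) ≡ w
  φ∘ψ (O j)   = trans (cong (λ t → φ (u [ t ]ₙ)) ([x+0]*2+0≡x*2 (toℕ j)))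
    (trans (φᵘ-even (toℕ j)) (cong O ([toℕ] j)))
  φ∘ψ (P B j) = trans (cong (λ t → φ (v [ t ]ₙ)) ([x+0]*2+0≡x*2 (toℕ j)))
    (trans (φᵛ-even (toℕ j)) (cong (P B) ([toℕ] j)))
  φ∘ψ (P A j) = trans (φᵘ-odd (toℕ j + (5 + 4 * g))) (cong (P A) (begin
      [ toℕ j + (5 + 4 * g) + 1 ]   ≡⟨ cong [_] (+-assoc (toℕ j) (5 + 4 * g) 1) ⟩
      [ toℕ j + (5 + 4 * g + 1) ]   ≡⟨ []-+≡ (toℕ j) 1 (solve (g ∷ [])) ⟩
      [ toℕ j ]                     ≡⟨ [toℕ] j ⟩
      j                             ∎))
    where open ≡-Reasoning
  φ∘ψ (P C j) = trans (φᵛ-odd (toℕ j + (1 + g))) (cong (P C) (begin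
      [ toℕ j + (1 + g) + (5 + 3 * g) ]   ≡⟨ cong [_] (+-assoc (toℕ j) (1 + g) (5 + 3 * g)) ⟩
      [ toℕ j + (1 + g + (5 + 3 * g)) ]   ≡⟨ []-+≡ (toℕ j) 1 (solve (g ∷ [])) ⟩
      [ toℕ j ]                           ≡⟨ [toℕ] j ⟩
      j                                   ∎))
    where open ≡-Reasoning

  index-view : ∀ (i : Fin n) → ∃ λ y → i ≡ [ y * 2 ]ₙ ⊎ i ≡ [ y * 2 + 1 ]ₙ
  index-view i with even-or-odd (toℕ i)
  ... | y , inj₁ e = y , inj₁ (trans (sym (ℤₙ.[toℕ] i)) (cong [_]ₙ e))
  ... | y , inj₂ e = y , inj₂ (trans (sym (ℤₙ.[toℕ] i)) (cong [_]ₙ e))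

  ψ∘φ : ∀ x → ψ (φ x) ≡ x
  ψ∘φ (u i) with index-view i
  ... | y , inj₁ refl = trans (cong ψ (φᵘ-even y))
                          (cong u (trans (double-[] 0 0 y) (cong [_]ₙ ([x+0]*2+0≡x*2 y))))
  ... | y , inj₂ refl = trans (cong ψ (φᵘ-odd y)) (cong u (trans (double-[] (5 + 4 * g) 1 (y + 1))
                          (ℤₙ.[]-≡′ ((y + 1 + (5 + 4 * g)) * 2 + 1) (y * 2 + 1) 0 1 (solve (y ∷ g ∷ [])))))
  ψ∘φ (v i) with index-view i
  ... | y , inj₁ refl = trans (cong ψ (φᵛ-even y))
                          (cong v (trans (double-[] 0 0 y) (cong [_]ₙ ([x+0]*2+0≡x*2 y))))
  ... | y , inj₂ refl = trans (cong ψ (φᵛ-odd y)) (cong v (trans (double-[] (1 + g) 1 (y + (5 + 3 * g)))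
                          (ℤₙ.[]-≡′ ((y + (5 + 3 * g) + (1 + g)) * 2 + 1) (y * 2 + 1) 0 1 (solve (y ∷ g ∷ [])))))

  NestGEdge : NestV n → NestV n → Set
  NestGEdge = NestEdge n 2 (3 + 2 * g) (5 + 2 * g) (5 + 4 * g)

  ~-resp-≡ : ∀ {x y x' y'} → x ≡ x' → y ≡ y' → x' ~ y' → x ~ y
  ~-resp-≡ refl refl a = a

  φᵘ-+ₘ : ∀ z a w → z + a ≡ w → φ (u ([ z ]ₙ +ₘ a)) ≡ φ (u [ w ]ₙ)
  φᵘ-+ₘ z a w e = cong (λ t → φ (u t)) (trans ([]ₙ-+ₘ z a) (cong [_]ₙ e))

  φᵛ-+ₘ : ∀ z a w → z + a ≡ w → φ (v ([ z ]ₙ +ₘ a)) ≡ φ (v [ w ]ₙ)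
  φᵛ-+ₘ z a w e = cong (λ t → φ (v t)) (trans ([]ₙ-+ₘ z a) (cong [_]ₙ e))

  φ-edge : ∀ {x y} → NestGEdge x y → φ x ~ φ y
  φ-edge (uu i) with index-view i
  ... | y , inj₁ refl = ~-resp-≡ (φᵘ-even y) (trans (φᵘ-+ₘ (y * 2) 1 (y * 2 + 1) refl) (φᵘ-odd y))
    (inj₁ (retarget ([]⊕ y 1) (spoke⁺ A [ y ])))
  ... | y , inj₂ refl = ~-resp-≡ (φᵘ-odd y)
    (trans (φᵘ-+ₘ (y * 2 + 1) 1 ((y + 1) * 2) (solve (y ∷ []))) (φᵘ-even (y + 1)))
    (inj₂ (spoke A [ y + 1 ]))
  φ-edge (uv0 i) with index-view i
  ... | y , inj₁ refl = ~-resp-≡ (φᵘ-even y) (φᵛ-even y) (inj₁ (spoke B [ y ]))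
  ... | y , inj₂ refl = ~-resp-≡ (φᵘ-odd y) (φᵛ-odd y)
    (inj₂ (retarget ([]⊕-≡ (y + (5 + 3 * g)) (2 + g) (y + 1) 0 1 (solve (y ∷ g ∷ []))) (rung⁺ C _)))
  φ-edge (uva i) with index-view i
  ... | y , inj₁ refl = ~-resp-≡ (φᵘ-even y)
    (trans (φᵛ-+ₘ (y * 2) 2 ((y + 1) * 2) (solve (y ∷ []))) (φᵛ-even (y + 1)))
    (inj₁ (retarget ([]⊕ y 1) (spoke⁺ B [ y ])))
  ... | y , inj₂ refl = ~-resp-≡ (φᵘ-odd y)
    (trans (φᵛ-+ₘ (y * 2 + 1) 2 ((y + 1) * 2 + 1) (solve (y ∷ []))) (φᵛ-odd (y + 1)))
    (inj₂ (retarget ([]⊕-≡ (y + 1 + (5 + 3 * g)) (1 + g) (y + 1) 0 1 (solve (y ∷ g ∷ []))) (rung C _)))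
  φ-edge (uvb i) with index-view i
  ... | y , inj₁ refl = ~-resp-≡ (φᵘ-even y)
    (trans (φᵛ-+ₘ (y * 2) (3 + 2 * g) ((y + (1 + g)) * 2 + 1) (solve (y ∷ g ∷ [])))
      (φᵛ-odd (y + (1 + g))))
    (inj₁ (retarget (sym ([]-≡′ (y + (1 + g) + (5 + 3 * g)) y 0 1 (solve (y ∷ g ∷ [])))) (spoke C [ y ])))
  ... | y , inj₂ refl = ~-resp-≡ (φᵘ-odd y)
    (trans (φᵛ-+ₘ (y * 2 + 1) (3 + 2 * g) ((y + (2 + g)) * 2) (solve (y ∷ g ∷ [])))
      (φᵛ-even (y + (2 + g))))
    (inj₁ (retarget ([]⊕-≡ (y + 1) (1 + g) (y + (2 + g)) 0 0 (solve (y ∷ g ∷ []))) (rung A _)))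
  φ-edge (uvc i) with index-view i
  ... | y , inj₁ refl = ~-resp-≡ (φᵘ-even y)
    (trans (φᵛ-+ₘ (y * 2) (5 + 2 * g) ((y + (2 + g)) * 2 + 1) (solve (y ∷ g ∷ [])))
      (φᵛ-odd (y + (2 + g))))
    (inj₁ (retarget ([]⊕-≡ y 1 (y + (2 + g) + (5 + 3 * g)) 1 0 (solve (y ∷ g ∷ []))) (spoke⁺ C [ y ])))
  ... | y , inj₂ refl = ~-resp-≡ (φᵘ-odd y)
    (trans (φᵛ-+ₘ (y * 2 + 1) (5 + 2 * g) ((y + (3 + g)) * 2) (solve (y ∷ g ∷ [])))
      (φᵛ-even (y + (3 + g))))
    (inj₁ (retarget ([]⊕-≡ (y + 1) (2 + g) (y + (3 + g)) 0 0 (solve (y ∷ g ∷ []))) (rung⁺ A _)))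
  φ-edge (vv i) with index-view i
  ... | y , inj₁ refl = ~-resp-≡ (φᵛ-even y)
    (trans (φᵛ-+ₘ (y * 2) (5 + 4 * g) ((y + (2 + 2 * g)) * 2 + 1) (solve (y ∷ g ∷ [])))
      (φᵛ-odd (y + (2 + 2 * g))))
    (inj₁ (retarget ([]⊕-≡ y (1 + g) (y + (2 + 2 * g) + (5 + 3 * g)) 1 0 (solve (y ∷ g ∷ [])))
      (rung B [ y ])))
  ... | y , inj₂ refl = ~-resp-≡ (φᵛ-odd y)
    (trans (φᵛ-+ₘ (y * 2 + 1) (5 + 4 * g) ((y + (3 + 2 * g)) * 2) (solve (y ∷ g ∷ [])))
      (φᵛ-even (y + (3 + 2 * g))))
    (inj₂ (retarget ([]⊕-≡ (y + (3 + 2 * g)) (2 + g) (y + (5 + 3 * g)) 0 0 (solve (y ∷ g ∷ []))) (rung⁺ B _)))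

  Adjᴺ-resp-≡˘ : ∀ {x y x' y'} → x' ≡ x → y' ≡ y → Adj NestG x' y' → Adj NestG x y
  Adjᴺ-resp-≡˘ refl refl a = a

  ψ-edge : ∀ {x y} → Edge x y → Adj NestG (ψ x) (ψ y)
  ψ-edge (spoke A j) = Adjᴺ-resp-≡˘
    (cong u (double-+ₘ (5 + 4 * g) 1 1 0 0 0 1 (solve (g ∷ [])) j)) refl
    (inj₂ (uu (double (5 + 4 * g) 1 j)))
  ψ-edge (spoke⁺ A j) = Adjᴺ-resp-≡˘ refl
    (cong u (double-+ₘ-⊕ 0 0 1 (5 + 4 * g) 1 1 1 0 (solve (g ∷ [])) j))
    (inj₁ (uu (double 0 0 j)))
  ψ-edge (spoke B j)  = inj₁ (uv0 (double 0 0 j))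
  ψ-edge (spoke⁺ B j) = Adjᴺ-resp-≡˘ refl
    (cong v (double-+ₘ-⊕ 0 0 2 0 0 1 0 0 refl j))
    (inj₁ (uva (double 0 0 j)))
  ψ-edge (spoke C j) = Adjᴺ-resp-≡˘ refl
    (cong v (double-+ₘ 0 0 (3 + 2 * g) (1 + g) 1 0 0 (solve (g ∷ [])) j))
    (inj₁ (uvb (double 0 0 j)))
  ψ-edge (spoke⁺ C j) = Adjᴺ-resp-≡˘ refl
    (cong v (double-+ₘ-⊕ 0 0 (5 + 2 * g) (1 + g) 1 1 0 0 (solve (g ∷ [])) j))
    (inj₁ (uvc (double 0 0 j)))
  ψ-edge (rung A j) = Adjᴺ-resp-≡˘ refl
    (cong v (double-+ₘ-⊕ (5 + 4 * g) 1 (3 + 2 * g) 0 0 (1 + g) 0 1 (solve (g ∷ [])) j))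
    (inj₁ (uvb (double (5 + 4 * g) 1 j)))
  ψ-edge (rung⁺ A j) = Adjᴺ-resp-≡˘ refl
    (cong v (double-+ₘ-⊕ (5 + 4 * g) 1 (5 + 2 * g) 0 0 (2 + g) 0 1 (solve (g ∷ [])) j))
    (inj₁ (uvc (double (5 + 4 * g) 1 j)))
  ψ-edge (rung B j) = Adjᴺ-resp-≡˘ refl
    (cong v (double-+ₘ-⊕ 0 0 (5 + 4 * g) (1 + g) 1 (1 + g) 0 0 (solve (g ∷ [])) j))
    (inj₁ (vv (double 0 0 j)))
  ψ-edge (rung⁺ B j) = Adjᴺ-resp-≡˘
    (cong v (double-⊕-+ₘ (1 + g) 1 (2 + g) (5 + 4 * g) 0 0 0 1 (solve (g ∷ [])) j)) refl
    (inj₂ (vv (double (1 + g) 1 (j ⊕ (2 + g)))))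
  ψ-edge (rung C j) = Adjᴺ-resp-≡˘
    (cong v (double-⊕-+ₘ (5 + 4 * g) 1 (1 + g) 2 (1 + g) 1 0 1 (solve (g ∷ [])) j)) refl
    (inj₂ (uva (double (5 + 4 * g) 1 (j ⊕ (1 + g)))))
  ψ-edge (rung⁺ C j) = Adjᴺ-resp-≡˘
    (cong v (double-⊕-+ₘ (5 + 4 * g) 1 (2 + g) 0 (1 + g) 1 0 1 (solve (g ∷ [])) j)) refl
    (inj₂ (uv0 (double (5 + 4 * g) 1 (j ⊕ (2 + g)))))

  NestG≅ModelGraph : Iso NestG ModelGraph
  NestG≅ModelGraph = record
    { to = φ ; from = ψ ; from∘to = ψ∘φ ; to∘from = φ∘ψ
    ; to-pres = λ { x y (inj₁ e) → φ-edge e ; x y (inj₂ e) → ~-sym (φ-edge e) }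
    ; from-pres = λ { x y (inj₁ e) → ψ-edge e ; x y (inj₂ e) → Nest-sym (ψ-edge e) } }
    where
      Nest-sym : ∀ {x y} → Adj NestG x y → Adj NestG y x
      Nest-sym (inj₁ e) = inj₂ e
      Nest-sym (inj₂ e) = inj₁ e

  NestG-arcTransitive : ArcTransitive NestG
  NestG-arcTransitive = ArcTransitive-transport NestG≅ModelGraph arcTransitive

  NestG-stabilizerOrder : ∀ x → StabilizerOrder NestG x 6
  NestG-stabilizerOrder x = StabilizerOrder-transport NestG≅ModelGraph x 6 (stabilizerOrder (φ x))

Nest-cong : (𝒫 : Graph → Set) → ∀ {n n' b c c' k k'} → n ≡ n' → c ≡ c' → k ≡ k' →
  𝒫 (Nest n 2 b c k) → 𝒫 (Nest n' 2 b c' k')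
Nest-cong 𝒫 refl refl refl p = p

odd≥3⇒≡3+2* : ∀ m → 3 ≤ m → m % 2 ≡ 1 → ∃ λ g → m ≡ 3 + 2 * g
odd≥3⇒≡3+2* m 3≤m m-odd with even-or-odd m
... | y , inj₁ refl = ⊥-elim (0≢1+n (trans (sym (m*n%n≡0 y 2)) m-odd))
... | zero , inj₂ refl = ⊥-elim (<⇒≱ 3≤m (s≤s z≤n))
... | suc g , inj₂ refl = g , solve (g ∷ [])

lemma3p4 : (m : ℕ) → 3 ≤ m → m % 2 ≡ 1 →
    ArcTransitive (Nest (4 * m) 2 m (m + 2) (2 * m ∸ 1)) ×
    (∀ (x : V (Nest (4 * m) 2 m (m + 2) (2 * m ∸ 1))) →
      StabilizerOrder (Nest (4 * m) 2 m (m + 2) (2 * m ∸ 1)) x 6)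
lemma3p4 m 3≤m m-odd with odd≥3⇒≡3+2* m 3≤m m-odd
... | g , refl =
  Nest-cong (λ G → ArcTransitive G × (∀ x → StabilizerOrder G x 6)) n≡ c≡ (cong (_∸ 1) k+1≡)
  (NestG-arcTransitive , NestG-stabilizerOrder)
  where
    open NestModel g
    n≡ : suc (suc ((5 + 4 * g) * 2)) ≡ 4 * (3 + 2 * g)
    n≡ = solve (g ∷ [])
    c≡ : 5 + 2 * g ≡ 3 + 2 * g + 2
    c≡ = solve (g ∷ [])
    k+1≡ : 6 + 4 * g ≡ 2 * (3 + 2 * g)
    k+1≡ = solve (g ∷ [])
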